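{- Every $\mathbb{P}_1$-condition $c = (\sigma^0_s, \sigma^1_s, X_s, C, U_s : s < k)$ has a valid branch, i.e. there is some $s < k$ such that $U_s \in \bigcap_{e \in C} \mathcal{U}_e$.
   Context: A binary string $\sigma$ is identified with the finite set $F_\sigma = \{x < |\sigma| : \sigma(x) = 1\}$, and $\sigma \subseteq A$ means $F_\sigma \subseteq A$. Fix an effective enumeration $\mathcal{U}_0, \mathcal{U}_1, \dots$ of all $\Sigma^0_1$ classes in $2^\omega$ upward closed under $\supseteq$. A largeness class is a class $\mathcal{A} \subseteq 2^\omega$ upward closed under $\supseteq$ such that for every $k$-cover $Y_0 \cup \dots \cup Y_{k-1} \supseteq \omega$ some $Y_j \in \mathcal{A}$. Fix a countable Turing ideal $\mathcal{M}$ such that every infinite binary tree in $\mathcal{M}$ has a path in $\mathcal{M}$, and sets $A^0 \cup A^1 = \omega$. $\mathbb{P}_1$ is the set of tuples $(\sigma^0_s, \sigma^1_s, X_s, C, U_s : s < k)$ ($\sigma^i_s$ binary strings, $X_s, U_s, C \subseteq \omega$) such that (a) $\sigma^i_s \subseteq A^i$ for every $i < 2$, $s < k$; (b) $X_s \cap \{0, \dots, \max_i |\sigma^i_s|\} = \emptyset$ and $U_s \subseteq X_s$ for every $s < k$; (c) $U_0, \dots, U_{k-1}$ is a $k$-cover of $\omega - \{0, \dots, \max_{i,s}|\sigma^i_s|\}$; (d) $\bigcap_{e \in C}\mathcal{U}_e$ is a largeness class containing only infinite sets; (e) the Turing jumps $X_s'$, the sets $U_s$ ($s<k$), and $C$ belong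 to $\mathcal{M}$. -}

module Defs where

open import Data.Nat using (ℕ; zero; suc; _≤_; _<_; _⊔_)
open import Data.Bool using (Bool; true; false)
open import Data.Fin using (Fin; zero; suc)
open import Data.List using (List; length; lookup)
open import Data.Product using (Σ; _×_)
open import Relation.Binary.PropositionalEquality using (_≡_)

Subset : Set
Subset = ℕ → Bool

_⊆ˢ_ : Subset → Subset → Set
X ⊆ˢ Y = ∀ n → X n ≡ true → Y n ≡ true

Class : Set₁
Class = Subset → Set

UpwardClosed : Class → Set
UpwardClosed 𝒜 = ∀ X Y → X ⊆ˢ Y → 𝒜 X → 𝒜 Y

-- binary strings; σ ⊆ A means F_σ = {x < |σ| : σ(x) = 1} ⊆ A
BinString : Set
BinString = List Bool

_⊆ᵇ_ : BinString → Subset → Set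
σ ⊆ᵇ A = (x : Fin (length σ)) → lookup σ x ≡ true → A (Data.Fin.toℕ x) ≡ true

CoversOf : (k : ℕ) → (Fin k → Subset) → (ℕ → Set) → Set
CoversOf k Y Z = ∀ n → Z n → Σ (Fin k) λ j → Y j n ≡ true

IsCover : (k : ℕ) → (Fin k → Subset) → Set
IsCover k Y = CoversOf k Y (λ _ → ℕ)

LargenessClass : Class → Set
LargenessClass 𝒜 = UpwardClosed 𝒜 × (∀ (k : ℕ) (Y : Fin k → Subset) → IsCover k Y → Σ (Fin k) λ j → 𝒜 (Y j))

Infinite : Subset → Set
Infinite X = ∀ n → Σ ℕ λ m → n ≤ m × X m ≡ true

OnlyInfinite : Class → Set
OnlyInfinite 𝒜 = ∀ X → 𝒜 X → Infinite X

⋂ : (ℕ → Class) → Subset → Class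
⋂ 𝒰 C X = ∀ e → C e ≡ true → 𝒰 e X

maxFin : (k : ℕ) → (Fin k → ℕ) → ℕ
maxFin zero f = 0
maxFin (suc k) f = f zero ⊔ maxFin k (λ s → f (suc s))

-- P₁-conditions.  Parameters: the enumeration 𝒰 of upward closed classes,
-- the Turing ideal M (as a membership predicate), the Turing jump, and A⁰, A¹.
record P₁Condition (𝒰 : ℕ → Class) (M : Subset → Set) (jump : Subset → Subset)
                   (A : Fin 2 → Subset) (k : ℕ) : Set where
  field
    σ : Fin 2 → Fin k → BinString
    X : Fin k → Subset
    C : Subset
    U : Fin k → Subset
    -- (a)
    σ⊆A : ∀ i s → σ i s ⊆ᵇ A i
    -- (b)
    X-avoid : ∀ s x → x ≤ (length (σ zero s) ⊔ length (σ (suc zero) s)) → X s x ≡ false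
    U⊆X : ∀ s → U s ⊆ˢ X s
    -- (c)
    U-cover : CoversOf k U (λ x → maxFin k (λ s → length (σ zero s) ⊔ length (σ (suc zero) s)) < x)
    -- (d)
    C-large : LargenessClass (⋂ 𝒰 C)
    C-inf : OnlyInfinite (⋂ 𝒰 C)
    -- (e)
    X'∈M : ∀ s → M (jump (X s))
    U∈M : ∀ s → M (U s)
    C∈M : M C

module Submission where

open import Defs
open import Data.Nat using (ℕ; zero; suc; _≤_; _<_; _≤ᵇ_; _≤?_; _⊔_)
open import Data.Nat.Properties using (≤-trans; ≰⇒>; ≤ᵇ⇒≤; ≤⇒≤ᵇ; 1+n≰n)
open import Data.Fin using (Fin; zero; suc)
open import Data.List using (length)
open import Data.Product using (Σ; _,_; proj₂)
open import Data.Bool using (true)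
open import Data.Bool.Properties using (T-≡)
open import Data.Empty using (⊥-elim)
open import Function.Bundles using (Equivalence)
open import Relation.Nullary using (¬_; yes; no)
open import Relation.Binary.PropositionalEquality using (_≡_)

upTo : ℕ → Subset
upTo m x = x ≤ᵇ m

upTo-finite : ∀ m → ¬ Infinite (upTo m)
upTo-finite m inf with inf (suc m)
... | x , m<x , x≤m = 1+n≰n (≤-trans m<x (≤ᵇ⇒≤ x m (Equivalence.from T-≡ x≤m)))

extendByUpTo : ∀ {k} → ℕ → (Fin k → Subset) → Fin (suc k) → Subset
extendByUpTo m Y zero    = upTo m
extendByUpTo m Y (suc s) = Y s

extendByUpTo-isCover : ∀ {k} m (Y : Fin k → Subset) →
                       CoversOf k Y (m <_) → IsCover (suc k) (extendByUpTo m Y)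
extendByUpTo-isCover m Y cov x _ with x ≤? m
... | yes x≤m = zero , Equivalence.to T-≡ (≤⇒≤ᵇ x≤m)
... | no  x≰m with cov x (≰⇒> x≰m)
...   | s , x∈Ys = suc s , x∈Ys

-- Adding the finite set {0, …, m} turns Y into a cover of ω; the member the largeness
-- class picks cannot be that finite set, since the class contains only infinite sets.
largeness-cofiniteCover : ∀ {𝒜 k} → LargenessClass 𝒜 → OnlyInfinite 𝒜 →
                          ∀ m (Y : Fin k → Subset) → CoversOf k Y (m <_) →
                          Σ (Fin k) λ s → 𝒜 (Y s)
largeness-cofiniteCover {k = k} (_ , large) onlyInf m Y cov
  with large (suc k) (extendByUpTo m Y) (extendByUpTo-isCover m Y cov)
... | zero  , 𝒜upTo = ⊥-elim (upTo-finite m (onlyInf (upTo m) 𝒜upTo))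
... | suc s , 𝒜Ys   = s , 𝒜Ys

lemma3p4 : (𝒰 : ℕ → Class) → (∀ e → UpwardClosed (𝒰 e)) →
           (M : Subset → Set) → (jump : Subset → Subset) →
           (A : Fin 2 → Subset) → (∀ x → Σ (Fin 2) λ i → A i x ≡ true) →
           (k : ℕ) → (c : P₁Condition 𝒰 M jump A k) →
           Σ (Fin k) λ s → ⋂ 𝒰 (P₁Condition.C c) (P₁Condition.U c s)
-- Only clauses (c) and (d) of the condition are needed.
lemma3p4 𝒰 _ M jump A _ k c =
  largeness-cofiniteCover C-large C-inf
    (maxFin k (λ s → length (σ zero s) ⊔ length (σ (suc zero) s))) U U-cover
  where open P₁Condition c
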